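{- If $G,H$ are ordered graphs such that $H\in\mathcal G_r(G)$ for some integer $r\ge0$, then $H$ is a subgraph of $G$ (that is, $H$ is isomorphic, as an ordered graph, to a subgraph of $G$ with the induced order).
   Context: An ordered graph is a finite simple graph with a linear order on its vertices. It is monotone bipartite if its vertex set splits as $X\cup Y$ with every vertex of $X$ before every vertex of $Y$ and every edge joining $X$ to $Y$ (edgeless graphs included). Canonical delayed decomposition of an ordered graph $(G,<)$, $V=V(G)$: build a rooted tree $T$ top-down, assigning to each node $x$ an interval $L(x)$ of $(V,<)$; the root has $L=V$. For a node $x$: (i) if $|L(x)|=1$, $x$ gets one child, a leaf identified with the vertex of $L(x)$; (ii) if $|L(x)|\ge2$ and $L(x)$ is a module (each vertex outside $L(x)$ is adjacent to all or none of $L(x)$), $x$ gets two children $y_1,y_2$ with $L(y_1)=\{u\}$, $u$ the minimum of $L(x)$, and $L(y_2)=L(x)\setminus\{u\}$; (iii) otherwise, with $u_1\sim u_2$ iff every $w$ in the interval between $u_1,u_2$ has the same neighbourhood in $V\setminus L(x)$ as $u_1$ and $u_2$, the classes of $\sim$ are intervals $I_1<\dots<I_k$ and $x$ gets children $y_1,\dots,y_k$ with $L(y_i)=I_i$. Nodes not in ancestor–descendant relation are ordered by $x<y$ iff $L(x)<L(y)$. For each node $x$, the quotient graph $G_x$ is the ordered graph on the grandchildren of $x$ (ordered by $<$) in which two non-sibling grandchildren $y,y'$ are adjacent iff $G$ has an edge between $L(y)$ and $L(y')$ (siblings non-adjacent). Labels: nodes without grandparent get label $\emptyset$; otherwise $x$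 (with grandparent $p^2(x)$; cousins = non-sibling nodes with same grandparent) gets $R$ if some cousin $x'>x$ has $xx'\in E(G_{p^2(x)})$, else $L$ if some cousin $x'<x$ has $xx'\in E(G_{p^2(x)})$, else $O$. If a node $y$ labelled $O$ is not the first child of its parent and its parent has at least $3$ children, its label is refined to $O_L$ (resp. $O_R$) if its immediately preceding sibling is labelled $L$ (resp. $R$). The type of a node is the label of its parent. Refined quotient graphs of $(G,<)$ (defined when $(G,<)$ is not monotone bipartite): take the canonical delayed decomposition. For each quotient graph $G_x$: if $G_x$ is monotone bipartite, $G_x$ is a refined quotient graph. Otherwise, if the first child of $x$ is labelled $O$, delete its children from $G_x$; every remaining vertex has type $R$, $L$, $O_R$ or $O_L$; put $R'=\{R,O_R\}$, $L'=\{L,O_L\}$, and classify each edge by whether the type of its left endpoint is in $R'$ or $L'$ and likewise for its right endpoint (classes $R'R',R'L',L'R',L'L'$). Four refined quotient graphs arise: the graph on the remaining vertices with the $R'R'$ edges, minus all vertices before the first and after the last vertex of type $R$; with the $R'L'$ edges, minus vertices before the first and after the last vertex of type $L$; with the $L'R'$ edges, minus vertices before the first and after the last vertex of type $R$; with the $L'L'$ edges, minus vertices before the first and after the last vertex of type $L$. $\mathcal G_0(G)=\{G\}$ and $\mathcal G_{i+1}(G)$ is the collection of all refined quotient graphs of all members of $\mathcal G_i(G)$ (monotone bipartite members contribute nothing). -}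

module Defs where

open import Data.Nat using (ℕ; zero; suc; _<_; _≤_; _<ᵇ_; _≤ᵇ_; _≡ᵇ_)
open import Data.Fin using (Fin; toℕ)
open import Data.Bool using (Bool; true; false; _∧_; _∨_; not; if_then_else_)
open import Data.Bool.ListAction using (all; any)
open import Data.List using (List; []; _∷_; length; map; concatMap; lookup; allFin; filterᵇ; zip; upTo)
open import Data.Maybe using (Maybe; just; nothing; _>>=_)
open import Data.Product using (Σ; ∃; _×_; _,_)
open import Data.Sum using (_⊎_)
open import Function using (Surjective)
open import Relation.Binary.PropositionalEquality using (_≡_)
open import Relation.Nullary using (¬_)

-- Ordered graphs.  Vertices are Fin n, ordered by the usual order of Fin
-- (i.e. by toℕ).  Adjacency is a Bool-valued relation.

record OGraph : Set where
  constructor mkOGraph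
  field
    n   : ℕ
    adj : Fin n → Fin n → Bool

open OGraph public

IsSimple : OGraph → Set
IsSimple G = (∀ u v → adj G u v ≡ adj G v u) × (∀ u → adj G u u ≡ false)

_≅_ : OGraph → OGraph → Set
H ≅ K = Σ (Fin (n H) → Fin (n K)) λ f →
          (∀ u v → toℕ u < toℕ v → toℕ (f u) < toℕ (f v))
        × Surjective _≡_ _≡_ f
        × (∀ u v → adj H u v ≡ adj K (f u) (f v))

-- H is isomorphic (as an ordered graph) to a subgraph of G with the induced
-- order: an order-preserving (hence injective) map of vertices sending edges
-- of H to edges of G.
IsOrderedSubgraphOf : OGraph → OGraph → Set
IsOrderedSubgraphOf H G = Σ (Fin (n H) → Fin (n G)) λ f →
    (∀ u v → toℕ u < toℕ v → toℕ (f u) < toℕ (f v))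
  × (∀ u v → adj H u v ≡ true → adj G (f u) (f v) ≡ true)

-- Monotone bipartite: some cut s with X = {v < s}, Y = {v ≥ s} and every
-- edge joining X to Y (edgeless graphs included).
MonotoneBipartite : OGraph → Set
MonotoneBipartite G = ∃ λ (s : ℕ) → ∀ u v → adj G u v ≡ true →
    (toℕ u < s × s ≤ toℕ v) ⊎ (toℕ v < s × s ≤ toℕ u)

fromList : {A : Set} → List A → (A → A → Bool) → OGraph
fromList vs a = mkOGraph (length vs) (λ i j → a (lookup vs i) (lookup vs j))

nth : {A : Set} → List A → ℕ → Maybe A
nth []       _       = nothing
nth (x ∷ xs) zero    = just x
nth (x ∷ xs) (suc i) = nth xs i

enumerate : {A : Set} → List A → List (ℕ × A)
enumerate xs = zip (upTo (length xs)) xs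

eqB : Bool → Bool → Bool
eqB true  b = b
eqB false b = not b

_≤F_ : {m : ℕ} → Fin m → Fin m → Bool
u ≤F v = toℕ u ≤ᵇ toℕ v

_≡F_ : {m : ℕ} → Fin m → Fin m → Bool
u ≡F v = toℕ u ≡ᵇ toℕ v

memF : {m : ℕ} → Fin m → List (Fin m) → Bool
memF u I = any (u ≡F_) I

minF maxF : {m : ℕ} → Fin m → Fin m → Fin m
minF u v = if u ≤F v then u else v
maxF u v = if u ≤F v then v else u

-- Canonical delayed decomposition.  Nodes are either inner nodes carrying
-- their interval L(x) (as the increasing list of its vertices) or leaves
-- (identified with a vertex).

data Node (m : ℕ) : Set where
  inner : List (Fin m) → Node m
  leaf  : Fin m → Node m

Lset : {m : ℕ} → Node m → List (Fin m)
Lset (inner I) = I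
Lset (leaf v)  = v ∷ []

module Decomp (G : OGraph) where

  V : List (Fin (n G))
  V = allFin (n G)

  outside : List (Fin (n G)) → List (Fin (n G))
  outside I = filterᵇ (λ w → not (memF w I)) V

  isModule : List (Fin (n G)) → Bool
  isModule I = all (λ w → all (adj G w) I ∨ all (λ u → not (adj G w u)) I) (outside I)

  sameNb : List (Fin (n G)) → Fin (n G) → Fin (n G) → Bool
  sameNb I u v = all (λ w → eqB (adj G u w) (adj G v w)) (outside I)

  sim : List (Fin (n G)) → Fin (n G) → Fin (n G) → Bool
  sim I u₁ u₂ = all (λ w → not (minF u₁ u₂ ≤F w ∧ w ≤F maxF u₁ u₂)
                           ∨ (sameNb I w u₁ ∧ sameNb I w u₂)) I

  -- the classes of ∼ in increasing order (each listed via its least element)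
  classes : List (Fin (n G)) → List (List (Fin (n G)))
  classes I = map (λ u → filterᵇ (sim I u) I)
                  (filterᵇ (λ u → not (any (λ v → (toℕ v <ᵇ toℕ u) ∧ sim I v u) I)) I)

  children : Node (n G) → List (Node (n G))
  children (leaf v)                    = []
  children (inner [])                  = []
  children (inner (u ∷ []))            = leaf u ∷ []
  children (inner (u ∷ w ∷ rest)) =
    if isModule (u ∷ w ∷ rest)
    then inner (u ∷ []) ∷ inner (w ∷ rest) ∷ []
    else map inner (classes (u ∷ w ∷ rest))

  root : Node (n G)
  root = inner V

  -- Paths address nodes of T; a path is written node-first:
  -- (i ∷ p) is the i-th child (from 0) of the node at p.  Hence the parent
  -- of the node at (i ∷ p) is at p and its grandparent at tail p.
  Path : Set
  Path = List ℕ

  nodeAt : Path → Maybe (Node (n G))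
  nodeAt []      = just root
  nodeAt (i ∷ p) = nodeAt p >>= λ x → nth (children x) i

  -- Grandchildren of a node, in increasing order: entries (i , j , y) with
  -- y the j-th child of the i-th child.
  Entry : Set
  Entry = ℕ × ℕ × Node (n G)

  grandchildren : Node (n G) → List Entry
  grandchildren x = concatMap (λ { (i , c) → map (λ { (j , y) → (i , j , y) }) (enumerate (children c)) })
                              (enumerate (children x))

  ltE : Entry → Entry → Bool
  ltE (i , j , _) (i' , j' , _) = (i <ᵇ i') ∨ ((i ≡ᵇ i') ∧ (j <ᵇ j'))

  edgeBetween : List (Fin (n G)) → List (Fin (n G)) → Bool
  edgeBetween A B = any (λ u → any (λ v → adj G u v) B) A

  -- adjacency in the quotient graph G_x: non-siblings with an edge of G
  -- between their intervals
  qadj : Entry → Entry → Bool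
  qadj (i , _ , y) (i' , _ , y') = not (i ≡ᵇ i') ∧ edgeBetween (Lset y) (Lset y')

  quotient : Node (n G) → OGraph
  quotient x = fromList (grandchildren x) qadj

  data Label : Set where
    ∅ R L O Oᴸ Oᴿ : Label

  isO isR isL : Label → Bool
  isO O = true
  isO _ = false
  isR R = true
  isR _ = false
  isL L = true
  isL _ = false

  -- unrefined label R / L / O (∅ for nodes without grandparent)
  baseLabel : Path → Label
  baseLabel []            = ∅
  baseLabel (_ ∷ [])      = ∅
  baseLabel (j ∷ i ∷ g) with nodeAt g | nodeAt (j ∷ i ∷ g)
  ... | just z | just x =
        let me  = (i , j , x)
            gcs = grandchildren z
        in if any (λ e → ltE me e ∧ qadj me e) gcs then R
           else if any (λ e → ltE e me ∧ qadj me e) gcs then L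
           else O
  ... | _ | _ = ∅

  label : Path → Label
  label []      = ∅
  label (k ∷ p) with baseLabel (k ∷ p) | k | nodeAt p
  ... | O | suc k' | just par =
        if 3 ≤ᵇ length (children par)
        then (refine (baseLabel (k' ∷ p)))
        else O
    where
      refine : Label → Label
      refine L = Oᴸ
      refine R = Oᴿ
      refine _ = O
  ... | b | _ | _ = b

  typeAt : Path → Entry → Label
  typeAt p (i , _ , _) = label (i ∷ p)

  inR' inL' : Label → Bool
  inR' R  = true
  inR' Oᴿ = true
  inR' _  = false
  inL' L  = true
  inL' Oᴸ = true
  inL' _  = false

  data EdgeClass : Set where
    R'R' R'L' L'R' L'L' : EdgeClass

  inClass : EdgeClass → Label → Label → Bool
  inClass R'R' a b = inR' a ∧ inR' b
  inClass R'L' a b = inR' a ∧ inL' b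
  inClass L'R' a b = inL' a ∧ inR' b
  inClass L'L' a b = inL' a ∧ inL' b

  trimType : EdgeClass → Label → Bool
  trimType R'R' = isR
  trimType R'L' = isL
  trimType L'R' = isR
  trimType L'L' = isL

  remaining : Path → Node (n G) → List Entry
  remaining p x =
    if isO (label (0 ∷ p))
    then filterᵇ (λ { (i , _ , _) → not (i ≡ᵇ 0) }) (grandchildren x)
    else grandchildren x

  refinedGraph : EdgeClass → Path → Node (n G) → OGraph
  refinedGraph c p x = fromList kept radj
    where
      rem = remaining p x
      t = typeAt p
      kept = filterᵇ (λ e → any (λ e' → not (ltE e e') ∧ trimType c (t e')) rem
                           ∧ any (λ e' → not (ltE e' e) ∧ trimType c (t e')) rem) rem
      radj : Entry → Entry → Bool
      radj e e' = qadj e e' ∧ (if ltE e e' then inClass c (t e) (t e') else inClass c (t e') (t e))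

IsRefinedQuotientGraph : OGraph → OGraph → Set
IsRefinedQuotientGraph K H =
  ¬ MonotoneBipartite K ×
  Σ (Path) λ p → Σ (Node (n K)) λ x → nodeAt p ≡ just x ×
    ( (MonotoneBipartite (quotient x) × H ≅ quotient x)
    ⊎ (¬ MonotoneBipartite (quotient x) × Σ EdgeClass λ c → H ≅ refinedGraph c p x))
  where open Decomp K

data InGen (G : OGraph) : ℕ → OGraph → Set where
  gen0   : ∀ {H} → H ≅ G → InGen G 0 H
  genSuc : ∀ {r K H} → InGen G r K → IsRefinedQuotientGraph K H → InGen G (suc r) H

-- Map every grandchild y of a node x of the decomposition to an arbitrary vertex of its
-- interval L(y).  This is order preserving because the intervals of the grandchildren are
-- pairwise disjoint and increasing.  It preserves edges: if some edge of G joins L(y) to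
-- L(y') where y, y' are children of distinct children z, z' of x, then, since every vertex
-- of L(y) has the same neighbours outside L(z) and every vertex of L(y') has the same
-- neighbours outside L(z'), all of L(y) is joined to all of L(y').  Hence every quotient
-- graph is an ordered subgraph of G; a refined quotient graph is an ordered subgraph of a
-- quotient graph on fewer vertices and edges, and quotient graphs of symmetric graphs are
-- symmetric, so the claim follows by induction on r.

module Submission where

open import Defs
open import Data.Bool using (Bool; true; false; T; T?; not; _∧_; _∨_; if_then_else_)
open import Data.Bool.Properties using (T-≡; T-not-≡; T-∧; T-∨)
open import Data.Bool.ListAction using (all; any)
open import Data.Empty using (⊥-elim)
open import Data.Fin using (Fin; zero; suc; toℕ)
open import Data.Fin.Properties using (toℕ-injective)
open import Data.List using (List; []; _∷_; length; lookup; map; zip; upTo; filterᵇ)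
open import Data.List.Membership.Propositional using (_∈_; _∉_; find; lose)
open import Data.List.Membership.Propositional.Properties using (∈-lookup; ∈-allFin; ∈-filter⁺; ∈-filter⁻)
open import Data.List.Relation.Binary.Subset.Propositional using (_⊆_)
import Data.List.Relation.Binary.Sublist.Propositional as Sublist
open Sublist using (_∷ʳ_; _∷_)
open import Data.List.Relation.Binary.Sublist.Propositional.Properties using (filter-⊆)
open import Data.List.Relation.Unary.All as All using (All; []; _∷_)
import Data.List.Relation.Unary.All.Properties as Allₚ
open import Data.List.Relation.Unary.AllPairs as AllPairs using (AllPairs; []; _∷_)
import Data.List.Relation.Unary.AllPairs.Properties as AllPairsₚ
open import Data.List.Relation.Unary.Any using (here; there)
import Data.List.Relation.Unary.Any.Properties as Anyₚ
open import Data.Maybe using (just)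
open import Data.Nat using (ℕ; _≤_; _<_; _⊓_; _⊔_; _≤ᵇ_; _<ᵇ_; _≡ᵇ_; z≤n; s≤s; _≤?_; _<?_)
open import Data.Nat.Properties
open import Data.Product using (∃; ∃₂; _×_; _,_; proj₁; proj₂; map₁)
import Data.Product as Product
open import Data.Sum using (inj₁; inj₂)
open import Function using (_∘_; id; _⇔_; mk⇔; Equivalence)
open import Relation.Binary.Definitions using (tri<; tri≈; tri>)
open import Relation.Binary.PropositionalEquality
open import Relation.Nullary using (¬_; yes; no; ofʸ; ofⁿ)

open Equivalence using (to; from)

private
  variable
    F G H : OGraph

IsSymmetric : OGraph → Set
IsSymmetric G = ∀ u v → adj G u v ≡ adj G v u

infix 4 _⊑_
_⊑_ : OGraph → OGraph → Set
_⊑_ = IsOrderedSubgraphOf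

⊑-trans : F ⊑ G → G ⊑ H → F ⊑ H
⊑-trans (f , f-mono , f-edge) (g , g-mono , g-edge) =
  g ∘ f , (λ u v u<v → g-mono _ _ (f-mono u v u<v)) , (λ u v uv → g-edge _ _ (f-edge u v uv))

≅⇒⊑ : H ≅ G → H ⊑ G
≅⇒⊑ (f , f-mono , _ , f-adj) = f , f-mono , λ u v uv → trans (sym (f-adj u v)) uv

≅-symmetric : H ≅ G → IsSymmetric G → IsSymmetric H
≅-symmetric (_ , _ , _ , f-adj) G-sym u v = trans (f-adj u v) (trans (G-sym _ _) (sym (f-adj v u)))

T-ext : ∀ {a b} → (T a → T b) → (T b → T a) → a ≡ b
T-ext {false} {false} _ _ = refl
T-ext {false} {true}  _ b⇒a = ⊥-elim (b⇒a _)
T-ext {true}  {false} a⇒b _ = ⊥-elim (a⇒b _)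
T-ext {true}  {true}  _ _ = refl

¬T⇒≡false : ∀ {b} → ¬ T b → b ≡ false
¬T⇒≡false {false} _ = refl
¬T⇒≡false {true}  ¬t = ⊥-elim (¬t _)

T-not⇒¬T : ∀ {b} → T (not b) → ¬ T b
T-not⇒¬T {false} _ ()

T-not-∨ : ∀ {b c} → T (not b ∨ c) ⇔ (T b → T c)
T-not-∨ {false} = mk⇔ (λ _ ()) _
T-not-∨ {true}  = mk⇔ (λ c _ → c) (λ b⇒c → b⇒c _)

T-eqB : ∀ {x y} → T (eqB x y) ⇔ x ≡ y
T-eqB {false} {false} = mk⇔ (λ _ → refl) _
T-eqB {false} {true}  = mk⇔ (λ ()) (λ ())
T-eqB {true}  {false} = mk⇔ (λ ()) (λ ())
T-eqB {true}  {true}  = mk⇔ (λ _ → refl) _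

≡ᵇ-sym : ∀ m n → (m ≡ᵇ n) ≡ (n ≡ᵇ m)
≡ᵇ-sym m n = T-ext (converse m n) (converse n m)
  where
  converse : ∀ m n → T (m ≡ᵇ n) → T (n ≡ᵇ m)
  converse m n t = ≡⇒≡ᵇ n m (sym (≡ᵇ⇒≡ m n t))

module _ {A : Set} where

  all-lookup : ∀ {p : A → Bool} {xs x} → T (all p xs) → x ∈ xs → T (p x)
  all-lookup {p} {xs} t = All.lookup (Allₚ.all⁺ p xs t)

  nth-∈ : ∀ {xs : List A} {i x} → nth xs i ≡ just x → x ∈ xs
  nth-∈ {_ ∷ _} {ℕ.zero}  refl = here refl
  nth-∈ {_ ∷ _} {ℕ.suc i} eq   = there (nth-∈ eq)

  allPairs-lookup : ∀ {R : A → A → Set} {xs} → AllPairs R xs →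
                    ∀ {i j} → toℕ i < toℕ j → R (lookup xs i) (lookup xs j)
  allPairs-lookup (r ∷ _)  {zero}  {suc j} _         = All.lookup r (∈-lookup j)
  allPairs-lookup (_ ∷ rs) {suc i} {suc j} (s≤s i<j) = allPairs-lookup rs i<j

  allPairs-assuming : ∀ {P : A → Set} {R : A → A → Set} {xs} → All P xs →
                      AllPairs (λ a b → P a → P b → R a b) xs → AllPairs R xs
  allPairs-assuming []       []       = []
  allPairs-assuming (p ∷ ps) (r ∷ rs) =
    All.zipWith (λ (r-p , q) → r-p p q) (r , ps) ∷ allPairs-assuming ps rs

module _ {A B : Set} where

  zip-All⁺ : ∀ {P : A × B → Set} (ms : List A) {ys} →
             All (λ y → ∀ m → P (m , y)) ys → All P (zip ms ys)
  zip-All⁺ []       _        = []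
  zip-All⁺ (_ ∷ _)  []       = []
  zip-All⁺ (m ∷ ms) (p ∷ ps) = p m ∷ zip-All⁺ ms ps

  zip-AllPairs⁺ : ∀ {R : A × B → A × B → Set} (ms : List A) {ys} →
                  AllPairs (λ y y' → ∀ m m' → R (m , y) (m' , y')) ys → AllPairs R (zip ms ys)
  zip-AllPairs⁺ []       _        = []
  zip-AllPairs⁺ (_ ∷ _)  []       = []
  zip-AllPairs⁺ (m ∷ ms) (r ∷ rs) =
    zip-All⁺ ms (All.map (λ r-y m' → r-y m m') r) ∷ zip-AllPairs⁺ ms rs

module _ {A : Set} where

  enumerate-All⁺ : ∀ {P : ℕ × A → Set} {ys} →
                   All (λ y → ∀ i → P (i , y)) ys → All P (enumerate ys)
  enumerate-All⁺ {ys = ys} = zip-All⁺ (upTo (length ys))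

  enumerate-AllPairs⁺ : ∀ {R : ℕ × A → ℕ × A → Set} {ys} →
                        AllPairs (λ y y' → ∀ i i' → R (i , y) (i' , y')) ys →
                        AllPairs R (enumerate ys)
  enumerate-AllPairs⁺ {ys = ys} = zip-AllPairs⁺ (upTo (length ys))

module _ {A : Set} where

  sublist-index : ∀ {xs ys : List A} → xs Sublist.⊆ ys → Fin (length xs) → Fin (length ys)
  sublist-index (_ ∷ʳ s) k       = suc (sublist-index s k)
  sublist-index (_ ∷ _)  zero    = zero
  sublist-index (_ ∷ s)  (suc k) = suc (sublist-index s k)

  sublist-index-mono : ∀ {xs ys : List A} (s : xs Sublist.⊆ ys) {k l} →
                       toℕ k < toℕ l → toℕ (sublist-index s k) < toℕ (sublist-index s l)
  sublist-index-mono (_ ∷ʳ s) k<l                       = s≤s (sublist-index-mono s k<l)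
  sublist-index-mono (_ ∷ _)  {zero}  {suc _} _         = s≤s z≤n
  sublist-index-mono (_ ∷ s)  {suc _} {suc _} (s≤s k<l) = s≤s (sublist-index-mono s k<l)

  sublist-index-lookup : ∀ {xs ys : List A} (s : xs Sublist.⊆ ys) k →
                         lookup ys (sublist-index s k) ≡ lookup xs k
  sublist-index-lookup (_ ∷ʳ s)  k       = sublist-index-lookup s k
  sublist-index-lookup (refl ∷ _) zero   = refl
  sublist-index-lookup (_ ∷ s)   (suc k) = sublist-index-lookup s k

  fromList-⊑ : ∀ {xs ys : List A} {r q : A → A → Bool} → xs Sublist.⊆ ys →
               (∀ {a b} → T (r a b) → T (q a b)) → fromList xs r ⊑ fromList ys q
  fromList-⊑ {xs} {ys} {r} {q} s r⇒q = sublist-index s , (λ _ _ → sublist-index-mono s) , edge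
    where
    edge : ∀ u v → r (lookup xs u) (lookup xs v) ≡ true →
           q (lookup ys (sublist-index s u)) (lookup ys (sublist-index s v)) ≡ true
    edge u v uv rewrite sublist-index-lookup s u | sublist-index-lookup s v =
      to T-≡ (r⇒q (from T-≡ uv))

-- The canonical delayed decomposition

module DecompositionProperties (K : OGraph) where
  open Decomp K

  Vertex : Set
  Vertex = Fin (n K)

  Sorted : List Vertex → Set
  Sorted = AllPairs (λ a b → toℕ a < toℕ b)

  infix 4 _≺_
  _≺_ : List Vertex → List Vertex → Set
  A ≺ B = ∀ {a b} → a ∈ A → b ∈ B → toℕ a < toℕ b

  ≺-disjoint : ∀ {A B a} → A ≺ B → a ∈ A → a ∉ B
  ≺-disjoint A≺B a∈A a∈B = <-irrefl refl (A≺B a∈A a∈B)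

  T-memF : ∀ {w : Vertex} {X} → T (memF w X) ⇔ w ∈ X
  T-memF {w} {X} = mk⇔ to′ (λ w∈X → Anyₚ.any⁺ _ (lose w∈X (≡⇒≡ᵇ (toℕ w) (toℕ w) refl)))
    where
    to′ : T (memF w X) → w ∈ X
    to′ t with find (Anyₚ.any⁻ _ X t)
    ... | v , v∈X , w≡v = subst (_∈ X) (sym (toℕ-injective (≡ᵇ⇒≡ _ _ w≡v))) v∈X

  ∈-outside : ∀ {w : Vertex} {X} → w ∈ outside X ⇔ w ∉ X
  ∈-outside {w} {X} = mk⇔
    (λ w∈ → T-not⇒¬T (proj₂ (∈-filter⁻ (T? ∘ (λ w → not (memF w X))) {xs = V} w∈))
            ∘ from T-memF)
    (λ w∉X → ∈-filter⁺ (T? ∘ (λ w → not (memF w X))) (∈-allFin w)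
                        (from T-not-≡ (¬T⇒≡false (w∉X ∘ to T-memF))))

  SameNbOutside : List Vertex → Vertex → Vertex → Set
  SameNbOutside X a b = ∀ {w} → w ∉ X → adj K a w ≡ adj K b w

  sameNb-sym : ∀ {X a b} → SameNbOutside X a b → SameNbOutside X b a
  sameNb-sym a~b w∉X = sym (a~b w∉X)

  sameNb-trans : ∀ {X a b c} → SameNbOutside X a b → SameNbOutside X b c → SameNbOutside X a c
  sameNb-trans a~b b~c w∉X = trans (a~b w∉X) (b~c w∉X)

  T-sameNb : ∀ {X a b} → T (sameNb X a b) ⇔ SameNbOutside X a b
  T-sameNb {X} {a} {b} =
    mk⇔ to′ (λ a~b → Allₚ.all⁻ _ (All.tabulate (λ w∈ → from T-eqB (a~b (to ∈-outside w∈)))))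
    where
    to′ : T (sameNb X a b) → SameNbOutside X a b
    to′ t w∉X = to T-eqB (all-lookup t (from ∈-outside w∉X))

  Between : Vertex → Vertex → Vertex → Set
  Between x y w = toℕ x ⊓ toℕ y ≤ toℕ w × toℕ w ≤ toℕ x ⊔ toℕ y

  between-left : ∀ {x y} → Between x y x
  between-left {x} {y} = m⊓n≤m (toℕ x) (toℕ y) , m≤m⊔n (toℕ x) (toℕ y)

  between-right : ∀ {x y} → Between x y y
  between-right {x} {y} = m⊓n≤n (toℕ x) (toℕ y) , m≤n⊔m (toℕ x) (toℕ y)

  ≤-between : ∀ {x y w} → toℕ x ≤ toℕ w → toℕ w ≤ toℕ y → Between x y w
  ≤-between {x} {y} x≤w w≤y =
    ≤-trans (m⊓n≤m (toℕ x) (toℕ y)) x≤w , ≤-trans w≤y (m≤n⊔m (toℕ x) (toℕ y))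

  ≥-between : ∀ {x y w} → toℕ y ≤ toℕ w → toℕ w ≤ toℕ x → Between x y w
  ≥-between {x} {y} y≤w w≤x =
    ≤-trans (m⊓n≤n (toℕ x) (toℕ y)) y≤w , ≤-trans w≤x (m≤m⊔n (toℕ x) (toℕ y))

  between-self : ∀ {x w} → Between x x w → w ≡ x
  between-self {x} (x≤w , w≤x) =
    toℕ-injective (≤-antisym (subst (_ ≤_) (⊔-idem (toℕ x)) w≤x)
                             (subst (_≤ _) (⊓-idem (toℕ x)) x≤w))

  between-convex : ∀ {x y x' y' w} → Between x y x' → Between x y y' →
                   Between x' y' w → Between x y w
  between-convex (x⊓y≤x' , x'≤x⊔y) (x⊓y≤y' , y'≤x⊔y) (x'⊓y'≤w , w≤x'⊔y') =
    ≤-trans (⊓-glb x⊓y≤x' x⊓y≤y') x'⊓y'≤w , ≤-trans w≤x'⊔y' (⊔-lub x'≤x⊔y y'≤x⊔y)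

  toℕ-minF : ∀ (x y : Vertex) → toℕ (minF x y) ≡ toℕ x ⊓ toℕ y
  toℕ-minF x y with toℕ x ≤ᵇ toℕ y | ≤ᵇ-reflects-≤ (toℕ x) (toℕ y)
  ... | true  | ofʸ x≤y = sym (m≤n⇒m⊓n≡m x≤y)
  ... | false | ofⁿ x≰y = sym (m≥n⇒m⊓n≡n (≰⇒≥ x≰y))

  toℕ-maxF : ∀ (x y : Vertex) → toℕ (maxF x y) ≡ toℕ x ⊔ toℕ y
  toℕ-maxF x y with toℕ x ≤ᵇ toℕ y | ≤ᵇ-reflects-≤ (toℕ x) (toℕ y)
  ... | true  | ofʸ x≤y = sym (m≤n⇒m⊔n≡n x≤y)
  ... | false | ofⁿ x≰y = sym (m≥n⇒m⊔n≡m (≰⇒≥ x≰y))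

  T-between : ∀ {x y w : Vertex} → T (minF x y ≤F w ∧ w ≤F maxF x y) ⇔ Between x y w
  T-between {x} {y} {w} = mk⇔
    (λ t → let min≤w , w≤max = to T-∧ t in
      subst (_≤ toℕ w) (toℕ-minF x y) (≤ᵇ⇒≤ _ _ min≤w) ,
      subst (toℕ w ≤_) (toℕ-maxF x y) (≤ᵇ⇒≤ _ _ w≤max))
    (λ (min≤w , w≤max) → from T-∧
      (≤⇒≤ᵇ (subst (_≤ toℕ w) (sym (toℕ-minF x y)) min≤w) ,
       ≤⇒≤ᵇ (subst (toℕ w ≤_) (sym (toℕ-maxF x y)) w≤max)))

  Similar : List Vertex → Vertex → Vertex → Set
  Similar X x y = ∀ {w} → w ∈ X → Between x y w → SameNbOutside X w x × SameNbOutside X w y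

  T-sim : ∀ {X x y} → T (sim X x y) ⇔ Similar X x y
  T-sim {X} {x} {y} = mk⇔ to′ (λ x∼y → Allₚ.all⁻ _ (All.tabulate (λ w∈X →
    from T-not-∨ (λ btw → from T-∧
      (Product.map (from T-sameNb) (from T-sameNb) (x∼y w∈X (to T-between btw)))))))
    where
    to′ : T (sim X x y) → Similar X x y
    to′ t w∈X btw = Product.map (to T-sameNb) (to T-sameNb)
                      (to T-∧ (to T-not-∨ (all-lookup t w∈X) (from T-between btw)))

  similar-refl : ∀ {X x} → Similar X x x
  similar-refl w∈X btw rewrite between-self btw = (λ _ → refl) , (λ _ → refl)

  similar-narrow : ∀ {X x y x' y'} → Similar X x y → x' ∈ X → y' ∈ X →
                   Between x y x' → Between x y y' → Similar X x' y'
  similar-narrow x∼y x'∈X y'∈X btw-x' btw-y' w∈X btw-w =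
    let w≈x = proj₁ (x∼y w∈X (between-convex btw-x' btw-y' btw-w)) in
    sameNb-trans w≈x (sameNb-sym (proj₁ (x∼y x'∈X btw-x'))) ,
    sameNb-trans w≈x (sameNb-sym (proj₁ (x∼y y'∈X btw-y')))

  IsLeader : List Vertex → Vertex → Set
  IsLeader X u = ∀ {v} → v ∈ X → toℕ v < toℕ u → ¬ Similar X v u

  T-leader : ∀ {X u} → T (not (any (λ v → (toℕ v <ᵇ toℕ u) ∧ sim X v u) X)) → IsLeader X u
  T-leader t v∈X v<u v∼u =
    T-not⇒¬T t (Anyₚ.any⁺ _ (lose v∈X (from T-∧ (<⇒<ᵇ v<u , from T-sim v∼u))))

  -- If b ≤ a then u' would be similar to the earlier vertex u (when u' ≤ a) or a (when a < u').
  classes-ordered : ∀ {X u u' a b} → u ∈ X → u' ∈ X → IsLeader X u' → toℕ u < toℕ u' →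
                    a ∈ X → Similar X u a → Similar X u' b → toℕ a < toℕ b
  classes-ordered {u = u} {u'} {a} {b} u∈X u'∈X u'-leader u<u' a∈X u∼a u'∼b with toℕ a <? toℕ b
  ... | yes a<b = a<b
  ... | no a≮b with toℕ u' ≤? toℕ a
  ...   | yes u'≤a = ⊥-elim (u'-leader u∈X u<u'
    (similar-narrow u∼a u∈X u'∈X between-left (≤-between (<⇒≤ u<u') u'≤a)))
  ...   | no u'≰a = ⊥-elim (u'-leader a∈X a<u'
    (similar-narrow u'∼b a∈X u'∈X (≥-between (≮⇒≥ a≮b) (<⇒≤ a<u')) between-left))
    where
    a<u' : toℕ a < toℕ u'
    a<u' = ≰⇒> u'≰a

  Uniform : List Vertex → List Vertex → Set
  Uniform X Y = ∀ {a b} → a ∈ Y → b ∈ Y → SameNbOutside X a b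

  record IsBlock (X Y : List Vertex) : Set where
    field
      ⊆-whole   : Y ⊆ X
      inhabited : ∃ (_∈ Y)
      sorted    : Sorted Y
      uniform   : Uniform X Y

  OrderedBlocks : List Vertex → List (Node (n K)) → Set
  OrderedBlocks X ys = AllPairs (λ y y' → Lset y ≺ Lset y') ys × All (IsBlock X ∘ Lset) ys

  singleton-block : ∀ {X u} → u ∈ X → IsBlock X (u ∷ [])
  singleton-block u∈X = record
    { ⊆-whole   = λ { (here refl) → u∈X }
    ; inhabited = _ , here refl
    ; sorted    = [] ∷ []
    ; uniform   = λ { (here refl) (here refl) _ → refl }
    }

  class-block : ∀ {X u} → Sorted X → u ∈ X → IsBlock X (filterᵇ (sim X u) X)
  class-block {X} {u} X-sorted u∈X = record
    { ⊆-whole   = proj₁ ∘ ∈-filter⁻ (T? ∘ sim X u) {xs = X}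
    ; inhabited = u , ∈-filter⁺ (T? ∘ sim X u) u∈X (from (T-sim {X} {u} {u}) similar-refl)
    ; sorted    = AllPairsₚ.filter⁺ (T? ∘ sim X u) X-sorted
    ; uniform   = λ a∈ b∈ → sameNb-trans (member-sameNb a∈) (sameNb-sym (member-sameNb b∈))
    }
    where
    member-sameNb : ∀ {a} → a ∈ filterᵇ (sim X u) X → SameNbOutside X a u
    member-sameNb a∈ = let a∈X , u∼a = ∈-filter⁻ (T? ∘ sim X u) {xs = X} a∈ in
      proj₁ (to T-sim u∼a a∈X between-right)

  classes-blocks : ∀ {X} → Sorted X → OrderedBlocks X (map inner (classes X))
  classes-blocks {X} X-sorted =
    AllPairsₚ.map⁺ (AllPairsₚ.map⁺ (allPairs-assuming leaders
      (AllPairs.map ordered (AllPairsₚ.filter⁺ (T? ∘ isLeader) X-sorted)))) ,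
    Allₚ.map⁺ (Allₚ.map⁺ (All.map (class-block X-sorted ∘ proj₁) leaders))
    where
    isLeader : Vertex → Bool
    isLeader u = not (any (λ v → (toℕ v <ᵇ toℕ u) ∧ sim X v u) X)
    leaders : All (λ u → u ∈ X × T (isLeader u)) (filterᵇ isLeader X)
    leaders = All.tabulate (∈-filter⁻ (T? ∘ isLeader))
    class : Vertex → List Vertex
    class u = filterᵇ (sim X u) X
    ordered : ∀ {u u'} → toℕ u < toℕ u' →
              u ∈ X × T (isLeader u) → u' ∈ X × T (isLeader u') → class u ≺ class u'
    ordered {u} {u'} u<u' (u∈X , _) (u'∈X , u'-leader) a∈ b∈ =
      let a∈X , u∼a = ∈-filter⁻ (T? ∘ sim X u) {xs = X} a∈
          _   , u'∼b = ∈-filter⁻ (T? ∘ sim X u') {xs = X} b∈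
      in classes-ordered u∈X u'∈X (T-leader u'-leader) u<u' a∈X (to T-sim u∼a) (to T-sim u'∼b)

  edgeBetween⁻ : ∀ {A B} → T (edgeBetween A B) → ∃₂ λ a b → a ∈ A × b ∈ B × T (adj K a b)
  edgeBetween⁻ {A} {B} t with find (Anyₚ.any⁻ _ A t)
  ... | a , a∈A , ta with find (Anyₚ.any⁻ _ B ta)
  ...   | b , b∈B , ab = a , b , a∈A , b∈B , ab

  edgeBetween⁺ : ∀ {A B a b} → a ∈ A → b ∈ B → T (adj K a b) → T (edgeBetween A B)
  edgeBetween⁺ a∈A b∈B ab = Anyₚ.any⁺ _ (lose a∈A (Anyₚ.any⁺ _ (lose b∈B ab)))

  node : Entry → Node (n K)
  node = proj₂ ∘ proj₂

  siblings-nonadjacent : ∀ {i j j'} {y y' : Node (n K)} → ¬ T (qadj (i , j , y) (i , j' , y'))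
  siblings-nonadjacent {i} t = T-not⇒¬T (proj₁ (to T-∧ t)) (≡⇒≡ᵇ i i refl)

  qadj-irreflexive : ∀ e → ¬ T (qadj e e)
  qadj-irreflexive (i , j , y) = siblings-nonadjacent {i} {j} {j} {y} {y}

  ltE-flip : ∀ e e' → T (qadj e e') → ltE e' e ≡ not (ltE e e')
  ltE-flip (i , j , y) (i' , j' , y') adjacent with <-cmp i i'
  ... | tri< i<i' i≢i' i'≮i rewrite to T-≡ (<⇒<ᵇ i<i')
                                  | ¬T⇒≡false (i'≮i ∘ <ᵇ⇒< i' i)
                                  | ¬T⇒≡false (i≢i' ∘ sym ∘ ≡ᵇ⇒≡ i' i) = refl
  ... | tri≈ _ refl _ = ⊥-elim (siblings-nonadjacent {i} {j} {j'} {y} {y'} adjacent)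
  ... | tri> i≮i' i≢i' i'<i rewrite to T-≡ (<⇒<ᵇ i'<i)
                                  | ¬T⇒≡false (i≮i' ∘ <ᵇ⇒< i i')
                                  | ¬T⇒≡false (i≢i' ∘ ≡ᵇ⇒≡ i i') = refl

  -- `oriented (edgeClass c p)` and `refinedVertices c p x` are the adjacency `radj` and the
  -- vertex list `kept` of `refinedGraph c p x`.
  oriented : (Entry → Entry → Bool) → Entry → Entry → Bool
  oriented κ e e' = qadj e e' ∧ (if ltE e e' then κ e e' else κ e' e)

  edgeClass : EdgeClass → Path → Entry → Entry → Bool
  edgeClass c p e e' = inClass c (typeAt p e) (typeAt p e')

  refinedVertices : EdgeClass → Path → Node (n K) → List Entry
  refinedVertices c p x = filterᵇ (λ e → any (λ e' → not (ltE e e') ∧ trimType c (typeAt p e')) rem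
                                       ∧ any (λ e' → not (ltE e' e) ∧ trimType c (typeAt p e')) rem) rem
    where
    rem = remaining p x

  remaining-⊆ : ∀ p x → remaining p x Sublist.⊆ grandchildren x
  remaining-⊆ p x with isO (label (0 ∷ p))
  ... | true  = filter-⊆ _ _
  ... | false = Sublist.⊆-refl

  refinedGraph-⊑ : ∀ c p x → refinedGraph c p x ⊑ quotient x
  refinedGraph-⊑ c p x = fromList-⊑ {r = oriented (edgeClass c p)} {q = qadj}
    (Sublist.⊆-trans (filter-⊆ _ _) (remaining-⊆ p x)) (proj₁ ∘ to T-∧)

-- Quotient graphs of a symmetric graph

module QuotientEmbedding (K : OGraph) (K-sym : IsSymmetric K) where
  open Decomp K
  open DecompositionProperties K
  open ≡-Reasoning

  isModule-uniform : ∀ {X} → T (isModule X) → Uniform X X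
  isModule-uniform {X} t {a} {b} a∈X b∈X {w} w∉X = begin
    adj K a w ≡⟨ K-sym a w ⟩
    adj K w a ≡⟨ all-or-none (all-lookup t (from ∈-outside w∉X)) ⟩
    adj K w b ≡⟨ K-sym w b ⟩
    adj K b w ∎
    where
    all-or-none : T (all (adj K w) X ∨ all (λ u → not (adj K w u)) X) → adj K w a ≡ adj K w b
    all-or-none t with to T-∨ t
    ... | inj₁ all-adj  =
      trans (to T-≡ (all-lookup all-adj a∈X)) (sym (to T-≡ (all-lookup all-adj b∈X)))
    ... | inj₂ none-adj =
      trans (to T-not-≡ (all-lookup none-adj a∈X)) (sym (to T-not-≡ (all-lookup none-adj b∈X)))

  module-blocks : ∀ {u w rest} → Sorted (u ∷ w ∷ rest) → T (isModule (u ∷ w ∷ rest)) →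
                  OrderedBlocks (u ∷ w ∷ rest) (inner (u ∷ []) ∷ inner (w ∷ rest) ∷ [])
  module-blocks {w = w} {rest} sorted is-module =
    ((λ { (here refl) b∈ → All.lookup (AllPairs.head sorted) b∈ }) ∷ []) ∷ [] ∷ [] ,
    singleton-block (here refl) ∷ rest-block ∷ []
    where
    rest-block : IsBlock _ (w ∷ rest)
    rest-block = record
      { ⊆-whole   = there
      ; inhabited = w , here refl
      ; sorted    = AllPairs.tail sorted
      ; uniform   = λ a∈ b∈ → isModule-uniform is-module (there a∈) (there b∈)
      }

  children-blocks : ∀ {x} → Sorted (Lset x) → OrderedBlocks (Lset x) (children x)
  children-blocks {leaf _}          _ = [] , []
  children-blocks {inner []}        _ = [] , []
  children-blocks {inner (_ ∷ [])}  _ = [] ∷ [] , singleton-block (here refl) ∷ []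
  children-blocks {inner (u ∷ w ∷ rest)} sorted with isModule (u ∷ w ∷ rest) in is-module
  ... | true  = module-blocks sorted (from T-≡ is-module)
  ... | false = classes-blocks sorted

  reachable-sorted : ∀ p {x} → nodeAt p ≡ just x → Sorted (Lset x)
  reachable-sorted []      refl = AllPairsₚ.tabulate⁺-< id
  reachable-sorted (i ∷ p) reached with nodeAt p in reached-parent
  ... | just z = IsBlock.sorted
    (All.lookup (proj₂ (children-blocks {z} (reachable-sorted p reached-parent))) (nth-∈ reached))

  Complete : List Vertex → List Vertex → Set
  Complete A B = ∀ {a b} → a ∈ A → b ∈ B → T (adj K a b)

  edge⇒complete : ∀ {Z Z' Y Y' a b} → Z ≺ Z' → IsBlock Z Y → IsBlock Z' Y' →
                  a ∈ Y → b ∈ Y' → T (adj K a b) → Complete Y Y'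
  edge⇒complete {a = a} {b} Z≺Z' Y-block Y'-block a∈Y b∈Y' ab {a₀} {b₀} a₀∈Y b₀∈Y' =
    subst T (sym a₀b₀≡ab) ab
    where
    open IsBlock
    a₀b₀≡ab : adj K a₀ b₀ ≡ adj K a b
    a₀b₀≡ab = begin
      adj K a₀ b₀ ≡⟨ K-sym a₀ b₀ ⟩
      adj K b₀ a₀ ≡⟨ uniform Y'-block b₀∈Y' b∈Y' a₀∉Z' ⟩
      adj K b a₀  ≡⟨ K-sym b a₀ ⟩
      adj K a₀ b  ≡⟨ uniform Y-block a₀∈Y a∈Y b∉Z ⟩
      adj K a b   ∎
      where
      a₀∉Z' = ≺-disjoint Z≺Z' (⊆-whole Y-block a₀∈Y)
      b∉Z   = λ b∈Z → ≺-disjoint Z≺Z' b∈Z (⊆-whole Y'-block b∈Y')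

  Linked : Entry → Entry → Set
  Linked e e' = Lset (node e) ≺ Lset (node e')
              × (T (qadj e e') → Complete (Lset (node e)) (Lset (node e')))

  siblings-linked : ∀ {i j j'} {y y' : Node (n K)} → Lset y ≺ Lset y' →
                    Linked (i , j , y) (i , j' , y')
  siblings-linked {i} {j} {j'} {y} {y'} y≺y' =
    y≺y' , ⊥-elim ∘ siblings-nonadjacent {i} {j} {j'} {y} {y'}

  cousins-linked : ∀ {Z Z' i j i' j'} {y y' : Node (n K)} → Z ≺ Z' →
                   IsBlock Z (Lset y) → IsBlock Z' (Lset y') → Linked (i , j , y) (i' , j' , y')
  cousins-linked Z≺Z' y-block y'-block =
    (λ a∈ b∈ → Z≺Z' (IsBlock.⊆-whole y-block a∈) (IsBlock.⊆-whole y'-block b∈)) ,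
    λ adjacent → let _ , _ , a∈ , b∈ , ab = edgeBetween⁻ (proj₂ (to T-∧ adjacent)) in
      edge⇒complete Z≺Z' y-block y'-block a∈ b∈ ab

  family : ℕ × Node (n K) → List Entry
  family (i , z) = map (i ,_) (enumerate (children z))

  Inhabited : Entry → Set
  Inhabited e = ∃ (_∈ Lset (node e))

  family-inhabited : ∀ {z} → Sorted (Lset z) → ∀ i → All Inhabited (family (i , z))
  family-inhabited {z} z-sorted i = Allₚ.map⁺ (enumerate-All⁺
    (All.map (λ y-block _ → IsBlock.inhabited y-block) (proj₂ (children-blocks {z} z-sorted))))

  family-linked : ∀ {z} → Sorted (Lset z) → ∀ i → AllPairs Linked (family (i , z))
  family-linked {z} z-sorted i = AllPairsₚ.map⁺ (enumerate-AllPairs⁺ (AllPairs.map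
    (λ {y} {y'} (y≺y' : Lset y ≺ Lset y') j j' → siblings-linked {i} {j} {j'} {y} {y'} y≺y')
    (proj₁ (children-blocks {z} z-sorted))))

  families-linked : ∀ {z z'} → Lset z ≺ Lset z' → Sorted (Lset z) → Sorted (Lset z') →
                    ∀ i i' → All (λ e → All (Linked e) (family (i' , z'))) (family (i , z))
  families-linked {z} {z'} z≺z' z-sorted z'-sorted i i' = Allₚ.map⁺ (enumerate-All⁺ (All.map
    (λ {y} y-block j → Allₚ.map⁺ (enumerate-All⁺ (All.map
      (λ {y'} y'-block j' → cousins-linked {i = i} {j} {i'} {j'} {y} {y'} z≺z' y-block y'-block)
      (proj₂ (children-blocks {z'} z'-sorted)))))
    (proj₂ (children-blocks {z} z-sorted))))

  grandchildren-inhabited : ∀ {x} → Sorted (Lset x) → All Inhabited (grandchildren x)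
  grandchildren-inhabited {x} x-sorted = Allₚ.concat⁺ (Allₚ.map⁺ (enumerate-All⁺ (All.map
    (λ {z} z-block → family-inhabited {z} (IsBlock.sorted z-block))
    (proj₂ (children-blocks {x} x-sorted)))))

  grandchildren-linked : ∀ {x} → Sorted (Lset x) → AllPairs Linked (grandchildren x)
  grandchildren-linked {x} x-sorted = AllPairsₚ.concat⁺
    (Allₚ.map⁺ (enumerate-All⁺
      (All.map (λ {z} z-block → family-linked {z} (IsBlock.sorted z-block)) blocks)))
    (AllPairsₚ.map⁺ (enumerate-AllPairs⁺ (allPairs-assuming blocks (AllPairs.map
      (λ {z} {z'} (z≺z' : Lset z ≺ Lset z') z-block z'-block →
         families-linked {z} {z'} z≺z' (IsBlock.sorted z-block) (IsBlock.sorted z'-block))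
      (proj₁ (children-blocks {x} x-sorted))))))
    where
    blocks = proj₂ (children-blocks {x} x-sorted)

  edgeBetween-sym : ∀ A B → edgeBetween A B ≡ edgeBetween B A
  edgeBetween-sym A B = T-ext (converse A B) (converse B A)
    where
    converse : ∀ A B → T (edgeBetween A B) → T (edgeBetween B A)
    converse A B t = let a , b , a∈A , b∈B , ab = edgeBetween⁻ t in
      edgeBetween⁺ {B} {A} b∈B a∈A (subst T (K-sym a b) ab)

  qadj-sym : ∀ e e' → qadj e e' ≡ qadj e' e
  qadj-sym (i , _ , y) (i' , _ , y') =
    cong₂ _∧_ (cong not (≡ᵇ-sym i i')) (edgeBetween-sym (Lset y) (Lset y'))

  oriented-sym : ∀ κ e e' → oriented κ e e' ≡ oriented κ e' e
  oriented-sym κ e e' rewrite qadj-sym e' e with qadj e e' in adjacent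
  ... | false = refl
  ... | true rewrite ltE-flip e e' (from T-≡ adjacent) with ltE e e'
  ...   | true  = refl
  ...   | false = refl

  linked-⊑ : ∀ {es} → All Inhabited es → AllPairs Linked es → fromList es qadj ⊑ K
  linked-⊑ {es} inhabited linked = f , mono , edge
    where
    f : Fin (length es) → Vertex
    f k = proj₁ (All.lookup inhabited (∈-lookup k))
    f∈ : ∀ k → f k ∈ Lset (node (lookup es k))
    f∈ k = proj₂ (All.lookup inhabited (∈-lookup k))
    mono : ∀ u v → toℕ u < toℕ v → toℕ (f u) < toℕ (f v)
    mono u v u<v = proj₁ (allPairs-lookup linked u<v) (f∈ u) (f∈ v)
    edge : ∀ u v → qadj (lookup es u) (lookup es v) ≡ true → adj K (f u) (f v) ≡ true
    edge u v uv with <-cmp (toℕ u) (toℕ v)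
    ... | tri< u<v _ _ = to T-≡ (proj₂ (allPairs-lookup linked u<v) (from T-≡ uv) (f∈ u) (f∈ v))
    ... | tri> _ _ v<u = trans (K-sym (f u) (f v)) (to T-≡ (proj₂ (allPairs-lookup linked v<u)
      (from T-≡ (trans (qadj-sym (lookup es v) (lookup es u)) uv)) (f∈ v) (f∈ u)))
    ... | tri≈ _ u≡v _ rewrite toℕ-injective u≡v =
      ⊥-elim (qadj-irreflexive (lookup es v) (from T-≡ uv))

  quotient-⊑ : ∀ p {x} → nodeAt p ≡ just x → quotient x ⊑ K
  quotient-⊑ p {x} reached =
    linked-⊑ (grandchildren-inhabited {x} sorted) (grandchildren-linked {x} sorted)
    where
    sorted = reachable-sorted p reached

  quotient-symmetric : ∀ x → IsSymmetric (quotient x)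
  quotient-symmetric x u v = qadj-sym (lookup (grandchildren x) u) (lookup (grandchildren x) v)

  refinedGraph-symmetric : ∀ c p x → IsSymmetric (refinedGraph c p x)
  refinedGraph-symmetric c p x u v =
    oriented-sym (edgeClass c p) (lookup (refinedVertices c p x) u) (lookup (refinedVertices c p x) v)

-- The collections 𝒢ᵣ(G)

≅-symmetric-⊑ : ∀ {H G K} → H ≅ G → G ⊑ K → IsSymmetric G → H ⊑ K × IsSymmetric H
≅-symmetric-⊑ {H} {G} {K} H≅G G⊑K G-sym =
  ⊑-trans {H} {G} {K} (≅⇒⊑ {H} {G} H≅G) G⊑K , ≅-symmetric {H} {G} H≅G G-sym

refinedQuotientGraph-⊑ : ∀ {K H} → IsSymmetric K → IsRefinedQuotientGraph K H →
                         H ⊑ K × IsSymmetric H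
refinedQuotientGraph-⊑ {K} {H} K-sym (_ , p , x , reached , inj₁ (_ , H≅Kₓ)) =
  ≅-symmetric-⊑ {H} {Decomp.quotient K x} {K} H≅Kₓ (quotient-⊑ p reached) (quotient-symmetric x)
  where open QuotientEmbedding K K-sym
refinedQuotientGraph-⊑ {K} {H} K-sym (_ , p , x , reached , inj₂ (_ , c , H≅R)) =
  ≅-symmetric-⊑ {H} {R} {K} H≅R
    (⊑-trans {R} {Decomp.quotient K x} {K} (refinedGraph-⊑ K c p x) (quotient-⊑ p reached))
    (refinedGraph-symmetric c p x)
  where
  open QuotientEmbedding K K-sym
  open DecompositionProperties using (refinedGraph-⊑)
  R = Decomp.refinedGraph K c p x

inGen-⊑ : ∀ {G r H} → IsSymmetric G → InGen G r H → H ⊑ G × IsSymmetric H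
inGen-⊑ {G} {H = H} G-sym (gen0 H≅G) = ≅⇒⊑ {H} {G} H≅G , ≅-symmetric {H} {G} H≅G G-sym
inGen-⊑ {G} G-sym (genSuc {K = K} {H} K∈𝒢 H-refined) with inGen-⊑ G-sym K∈𝒢
... | K⊑G , K-sym =
  map₁ (λ H⊑K → ⊑-trans {H} {K} {G} H⊑K K⊑G) (refinedQuotientGraph-⊑ K-sym H-refined)

lemma17 : (G H : OGraph) → IsSimple G → IsSimple H → (r : ℕ) →
    InGen G r H → IsOrderedSubgraphOf H G
lemma17 G H (G-sym , _) _ r H∈𝒢 = proj₁ (inGen-⊑ G-sym H∈𝒢)
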